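{- Let $G$ be a graph, let $C$ be a $5$-circuit of $G$ all of whose vertices have degree three in $G$, let $\phi$ be a $C$-extensible chain on $G$ such that $C$ has a nowhere-zero boundary in $\phi$, let $o$ be a natural $C$-boundary-ordering, and let $\phi(C,o)=a_0a_1a_2a_3a_4$. If $a_i=a_{i+1}=a_{i+2}$ for some $i\in\{0,\dots,4\}$ (indices modulo $5$), then there exists a flow $\phi'$ on $G$ that is a $C$-extension of $\phi$ such that $Z(\phi')\cap E(C)=\emptyset$.
   Context: Graphs are finite and may have parallel edges. A circuit is a connected $2$-regular subgraph; a $5$-circuit has $5$ edges. Let $\mathbb{Z}_2\times\mathbb{Z}_2$ have identity $0$. For a vertex $v$, $\partial_G(v)$ is the set of edges with exactly one end at $v$; for a subgraph $H$, $\partial_G(H)$ is the multiset of edges of $E(G)\setminus E(H)$ in which each edge appears as many times as the number of its endvertices in $V(H)$. A chain is a function $\phi:E(G)\to\mathbb{Z}_2\times\mathbb{Z}_2$, $Z(\phi)=\{e:\phi(e)=0\}$; $v$ is zero-sum if $\sum_{e\in\partial_G(v)}\phi(e)=0$; a flow is a chain with all vertices zero-sum. For a connected subgraph $H$: $\phi$ is $H$-extensible if all vertices outside $V(H)$ are zero-sum; $H$ has a nowhere-zero boundary in $\phi$ if $\partial_G(H)\cap Z(\phi)=\emptyset$; a flow $\phi'$ is an $H$-extension of $\phi$ if $\phi'=\phi$ on $E(G)\setminus E(H)$. If $C$ is a circuit whose vertices all have degree $3$ in $G$ and $v_0,\dots,v_{k-1}$ are its vertices in consecutive order along $C$, the natural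 $C$-boundary-ordering is $o=e_0,\dots,e_{k-1}$ where $e_i$ is the unique edge not in $E(C)$ incident with $v_i$, and $\phi(C,o)$ denotes the string $\phi(e_0)\phi(e_1)\cdots\phi(e_{k-1})$. -}

module Defs where

open import Data.Nat using (ℕ; zero; suc; _+_)
open import Data.Fin using (Fin; zero; suc; _≟_)
open import Data.Bool using (Bool; true; false; _xor_; if_then_else_)
open import Data.Product using (_×_; _,_; ∃; ∃-syntax)
open import Data.Sum using (_⊎_)
open import Relation.Nullary using (¬_)
open import Relation.Nullary.Decidable using (⌊_⌋)
open import Relation.Binary.PropositionalEquality using (_≡_)
open import Function.Definitions using (Injective)

-- The Klein four-group Z2 × Z2, as pairs of booleans with componentwise xor.
K : Set
K = Bool × Bool

0K : K
0K = (false , false)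

_⊕_ : K → K → K
(a , b) ⊕ (c , d) = (a xor c , b xor d)

sumK : (m : ℕ) → (Fin m → K) → K
sumK zero    f = 0K
sumK (suc m) f = f zero ⊕ sumK m (λ i → f (suc i))

sumℕ : (m : ℕ) → (Fin m → ℕ) → ℕ
sumℕ zero    f = 0
sumℕ (suc m) f = f zero + sumℕ m (λ i → f (suc i))

-- A finite multigraph (parallel edges and loops allowed): n vertices, m edges,
-- edge e has endvertices src e and tgt e.
record Graph : Set where
  field
    n   : ℕ
    m   : ℕ
    src : Fin m → Fin n
    tgt : Fin m → Fin n
open Graph public

Vertex : Graph → Set
Vertex G = Fin (n G)

Edge : Graph → Set
Edge G = Fin (m G)

b2n : Bool → ℕ
b2n true  = 1
b2n false = 0

-- degree: number of edge-ends at v (a loop counts twice)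
degree : (G : Graph) → Vertex G → ℕ
degree G v = sumℕ (m G) (λ e → b2n ⌊ src G e ≟ v ⌋ + b2n ⌊ tgt G e ≟ v ⌋)

-- e has exactly one end at v (i.e. e ∈ ∂_G(v))
inBoundary : (G : Graph) → Vertex G → Edge G → Bool
inBoundary G v e = ⌊ src G e ≟ v ⌋ xor ⌊ tgt G e ≟ v ⌋

Incident : (G : Graph) → Vertex G → Edge G → Set
Incident G v e = (src G e ≡ v) ⊎ (tgt G e ≡ v)

Joins : (G : Graph) → Edge G → Vertex G → Vertex G → Set
Joins G e u w = ((src G e ≡ u) × (tgt G e ≡ w)) ⊎ ((src G e ≡ w) × (tgt G e ≡ u))

Chain : Graph → Set
Chain G = Edge G → K

Z : (G : Graph) → Chain G → Edge G → Set
Z G φ e = φ e ≡ 0K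

ZeroSum : (G : Graph) → Chain G → Vertex G → Set
ZeroSum G φ v = sumK (m G) (λ e → if inBoundary G v e then φ e else 0K) ≡ 0K

Flow : (G : Graph) → Chain G → Set
Flow G φ = ∀ v → ZeroSum G φ v

next : Fin 5 → Fin 5
next zero = suc zero
next (suc zero) = suc (suc zero)
next (suc (suc zero)) = suc (suc (suc zero))
next (suc (suc (suc zero))) = suc (suc (suc (suc zero)))
next (suc (suc (suc (suc zero)))) = zero

-- A 5-circuit of G, given with its vertices v₀,…,v₄ in consecutive order
-- and its edges c₀,…,c₄, where cᵢ joins vᵢ and vᵢ₊₁ (indices mod 5).
record Circuit5 (G : Graph) : Set where
  field
    vtx      : Fin 5 → Vertex G
    edg      : Fin 5 → Edge G
    vtx-inj  : Injective _≡_ _≡_ vtx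
    edg-inj  : Injective _≡_ _≡_ edg
    edg-join : ∀ i → Joins G (edg i) (vtx i) (vtx (next i))
open Circuit5 public

InV : {G : Graph} → Circuit5 G → Vertex G → Set
InV C v = ∃[ j ] (vtx C j ≡ v)

InE : {G : Graph} → Circuit5 G → Edge G → Set
InE C e = ∃[ j ] (edg C j ≡ e)

Cubic-on : (G : Graph) → Circuit5 G → Set
Cubic-on G C = ∀ i → degree G (vtx C i) ≡ 3

Extensible : (G : Graph) → Circuit5 G → Chain G → Set
Extensible G C φ = ∀ v → ¬ InV C v → ZeroSum G φ v

NowhereZeroBoundary : (G : Graph) → Circuit5 G → Chain G → Set
NowhereZeroBoundary G C φ =
  ∀ e → ¬ InE C e → (∃[ j ] Incident G (vtx C j) e) → ¬ Z G φ e

NaturalOrdering : (G : Graph) → Circuit5 G → (Fin 5 → Edge G) → Set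
NaturalOrdering G C o = ∀ i → ¬ InE C (o i) × Incident G (vtx C i) (o i)

Extension : (G : Graph) → Circuit5 G → Chain G → Chain G → Set
Extension G C φ φ' = Flow G φ' × (∀ e → ¬ InE C e → φ' e ≡ φ e)

module Submission where

-- Off C nothing changes, so only the values c₀,…,c₄ of φ′ on the circuit edges are free; as every
-- vᵢ has degree 3, the flow condition at vᵢ reads cᵢ₋₁ + cᵢ = aᵢ. This system is solvable since
-- a₀ + ⋯ + a₄ = 0: summing the boundary sums of any chain over all vertices counts every edge twice,
-- and φ is zero-sum off C. Its solutions are cⱼ = y + a₁ + ⋯ + aⱼ. If aᵢ = aᵢ₊₁ = aᵢ₊₂ the partial
-- sums (started at i) take at most three values, so in the four-element group some y avoids all of
-- them, and then every cⱼ is nonzero.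

open import Defs
open import Algebra.Bundles using (CommutativeMonoid)
open import Algebra.Structures using (IsCommutativeMonoid)
open import Data.Bool using (true; false; _xor_; if_then_else_)
open import Data.Bool.Properties using (xor-assoc; xor-comm; xor-identityʳ; xor-same)
open import Data.Empty using (⊥-elim)
open import Data.Fin using (Fin; zero; suc; _≟_)
open import Data.Fin.Patterns using (0F; 1F; 2F; 3F; 4F)
open import Data.Fin.Properties using (any?; 0≢1+n) renaming (suc-injective to Fin-suc-injective)
open import Data.Nat using (ℕ; zero; suc; _+_; _≤_; z≤n; s≤s)
open import Data.Nat.Properties using (+-0-commutativeMonoid; m≤m+n; m≤n+m; n≤0⇒n≡0; suc-injective)
open import Data.Product using (_×_; _,_; ∃-syntax; proj₁; proj₂)
open import Data.Sum using (_⊎_; inj₁; inj₂)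
open import Data.Vec.Functional using (Vector; updateAt; []; _∷_)
open import Data.Vec.Functional.Properties using (updateAt-updates; updateAt-minimal)
open import Function using (_∘_)
open import Function.Definitions using (Injective)
open import Level using (0ℓ)
open import Relation.Nullary using (¬_; yes; no)
open import Relation.Nullary.Decidable using (⌊_⌋; isYes≗does; dec-true; dec-false)
open import Relation.Binary.PropositionalEquality
  using (_≡_; _≢_; refl; sym; trans; cong; cong₂; subst; subst₂; isEquivalence; module ≡-Reasoning)

⊕-assoc : ∀ x y z → (x ⊕ y) ⊕ z ≡ x ⊕ (y ⊕ z)
⊕-assoc (a , b) (c , d) (e , f) = cong₂ _,_ (xor-assoc a c e) (xor-assoc b d f)

⊕-comm : ∀ x y → x ⊕ y ≡ y ⊕ x
⊕-comm (a , b) (c , d) = cong₂ _,_ (xor-comm a c) (xor-comm b d)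

⊕-identityˡ : ∀ x → 0K ⊕ x ≡ x
⊕-identityˡ _ = refl

⊕-identityʳ : ∀ x → x ⊕ 0K ≡ x
⊕-identityʳ (a , b) = cong₂ _,_ (xor-identityʳ a) (xor-identityʳ b)

⊕-self : ∀ x → x ⊕ x ≡ 0K
⊕-self (a , b) = cong₂ _,_ (xor-same a) (xor-same b)

⊕-isCommutativeMonoid : IsCommutativeMonoid _≡_ _⊕_ 0K
⊕-isCommutativeMonoid = record
  { isMonoid = record
    { isSemigroup = record
      { isMagma = record { isEquivalence = isEquivalence ; ∙-cong = cong₂ _⊕_ }
      ; assoc = ⊕-assoc }
    ; identity = ⊕-identityˡ , ⊕-identityʳ }
  ; comm = ⊕-comm }

⊕-commutativeMonoid : CommutativeMonoid 0ℓ 0ℓ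
⊕-commutativeMonoid = record { isCommutativeMonoid = ⊕-isCommutativeMonoid }

⊕-cancelˡ : ∀ x y → x ⊕ (x ⊕ y) ≡ y
⊕-cancelˡ x y = trans (sym (⊕-assoc x x y)) (cong (_⊕ y) (⊕-self x))

⊕-cancelʳ : ∀ x y → (x ⊕ y) ⊕ x ≡ y
⊕-cancelʳ x y = trans (⊕-comm (x ⊕ y) x) (⊕-cancelˡ x y)

⊕-difference : ∀ x y z → (x ⊕ y) ⊕ (x ⊕ z) ≡ y ⊕ z
⊕-difference x y z = begin
  (x ⊕ y) ⊕ (x ⊕ z) ≡⟨ ⊕-assoc x y (x ⊕ z) ⟩
  x ⊕ (y ⊕ (x ⊕ z)) ≡⟨ cong (x ⊕_) (sym (⊕-assoc y x z)) ⟩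
  x ⊕ ((y ⊕ x) ⊕ z) ≡⟨ cong (λ w → x ⊕ (w ⊕ z)) (⊕-comm y x) ⟩
  x ⊕ ((x ⊕ y) ⊕ z) ≡⟨ cong (x ⊕_) (⊕-assoc x y z) ⟩
  x ⊕ (x ⊕ (y ⊕ z)) ≡⟨ ⊕-cancelˡ x (y ⊕ z) ⟩
  y ⊕ z             ∎
  where open ≡-Reasoning

⊕≡0K⇒≡ : ∀ {x y} → x ⊕ y ≡ 0K → x ≡ y
⊕≡0K⇒≡ {x} {y} x⊕y≡0 = begin
  x           ≡⟨ ⊕-identityʳ x ⟨
  x ⊕ 0K      ≡⟨ cong (x ⊕_) x⊕y≡0 ⟨
  x ⊕ (x ⊕ y) ≡⟨ ⊕-cancelˡ x y ⟩
  y           ∎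
  where open ≡-Reasoning

x⊕y≡z⇒x⊕[y⊕z]≡0K : ∀ {x y z} → x ⊕ y ≡ z → x ⊕ (y ⊕ z) ≡ 0K
x⊕y≡z⇒x⊕[y⊕z]≡0K {x} {y} {z} x⊕y≡z =
  trans (sym (⊕-assoc x y z)) (trans (cong (_⊕ z) x⊕y≡z) (⊕-self z))

avoid-0-and-two : ∀ p q → ∃[ y ] (y ≢ 0K × y ≢ p × y ≢ q)
avoid-0-and-two (false , false) (false , false) = (false , true) , (λ ()) , (λ ()) , (λ ())
avoid-0-and-two (false , false) (false , true)  = (true , false) , (λ ()) , (λ ()) , (λ ())
avoid-0-and-two (false , false) (true , false)  = (false , true) , (λ ()) , (λ ()) , (λ ())
avoid-0-and-two (false , false) (true , true)   = (false , true) , (λ ()) , (λ ()) , (λ ())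
avoid-0-and-two (false , true)  (false , false) = (true , false) , (λ ()) , (λ ()) , (λ ())
avoid-0-and-two (false , true)  (false , true)  = (true , false) , (λ ()) , (λ ()) , (λ ())
avoid-0-and-two (false , true)  (true , false)  = (true , true)  , (λ ()) , (λ ()) , (λ ())
avoid-0-and-two (false , true)  (true , true)   = (true , false) , (λ ()) , (λ ()) , (λ ())
avoid-0-and-two (true , false)  (false , false) = (false , true) , (λ ()) , (λ ()) , (λ ())
avoid-0-and-two (true , false)  (false , true)  = (true , true)  , (λ ()) , (λ ()) , (λ ())
avoid-0-and-two (true , false)  (true , false)  = (false , true) , (λ ()) , (λ ()) , (λ ())
avoid-0-and-two (true , false)  (true , true)   = (false , true) , (λ ()) , (λ ()) , (λ ())
avoid-0-and-two (true , true)   (false , false) = (false , true) , (λ ()) , (λ ()) , (λ ())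
avoid-0-and-two (true , true)   (false , true)  = (true , false) , (λ ()) , (λ ()) , (λ ())
avoid-0-and-two (true , true)   (true , false)  = (false , true) , (λ ()) , (λ ()) , (λ ())
avoid-0-and-two (true , true)   (true , true)   = (false , true) , (λ ()) , (λ ()) , (λ ())

⌊≟⌋-≡ : ∀ {k} {x y : Fin k} → x ≡ y → ⌊ x ≟ y ⌋ ≡ true
⌊≟⌋-≡ {x = x} {y} x≡y = trans (isYes≗does (x ≟ y)) (dec-true (x ≟ y) x≡y)

⌊≟⌋-≢ : ∀ {k} {x y : Fin k} → x ≢ y → ⌊ x ≟ y ⌋ ≡ false
⌊≟⌋-≢ {x = x} {y} x≢y = trans (isYes≗does (x ≟ y)) (dec-false (x ≟ y) x≢y)

⌊≟⌋⇒≡ : ∀ {k} (x y : Fin k) → ⌊ x ≟ y ⌋ ≡ true → x ≡ y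
⌊≟⌋⇒≡ x y with x ≟ y
... | yes x≡y = λ _ → x≡y
... | no _    = λ ()

module FiniteSum {c ℓ} (𝕄 : CommutativeMonoid c ℓ) where

  open CommutativeMonoid 𝕄
    using (Carrier; _≈_; _∙_; ε; ∙-congˡ; identityˡ; identityʳ; setoid; reflexive; commutativeSemigroup)
    renaming (sym to ≈-sym; trans to ≈-trans)
  open import Algebra.Properties.CommutativeMonoid.Sum 𝕄 public
    using (sum; sum-syntax; sum-cong-≋; sum-cong-≗; sum-replicate-zero; ∑-distrib-+; ∑-comm)
  open import Algebra.Properties.CommutativeSemigroup commutativeSemigroup using (x∙yz≈y∙xz)
  open import Relation.Binary.Reasoning.Setoid setoid

  infixl 6 _∖_

  _∖_ : ∀ {n} → Vector Carrier n → Fin n → Vector Carrier n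
  t ∖ i = updateAt t i (λ _ → ε)

  sum-∖ : ∀ {n} (t : Vector Carrier n) i → sum t ≈ t i ∙ sum (t ∖ i)
  sum-∖ t zero = ∙-congˡ (≈-sym (identityˡ _))
  sum-∖ t (suc i) = begin
    t zero ∙ sum (t ∘ suc)                       ≈⟨ ∙-congˡ (sum-∖ (t ∘ suc) i) ⟩
    t zero ∙ (t (suc i) ∙ sum ((t ∘ suc) ∖ i))   ≈⟨ x∙yz≈y∙xz _ _ _ ⟩
    t (suc i) ∙ (t zero ∙ sum ((t ∘ suc) ∖ i))   ∎

  sum-zero : ∀ {n} (t : Vector Carrier n) → (∀ i → t i ≈ ε) → sum t ≈ ε
  sum-zero {n} t t≈ε = ≈-trans (sum-cong-≋ t≈ε) (sum-replicate-zero n)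

  sum-∘-injective : ∀ {k n} (g : Fin k → Fin n) (t : Vector Carrier n) → Injective _≡_ _≡_ g →
    (∀ v → ¬ (∃[ j ] g j ≡ v) → t v ≈ ε) → sum t ≈ sum (t ∘ g)
  sum-∘-injective {zero} g t _ outside = sum-zero t (λ v → outside v λ ())
  sum-∘-injective {suc k} g t g-inj outside = begin
    sum t                             ≈⟨ sum-∖ t (g zero) ⟩
    t (g zero) ∙ sum (t ∖ g zero)     ≈⟨ ∙-congˡ (sum-∘-injective (g ∘ suc) _ g∘suc-inj outside′) ⟩
    t (g zero) ∙ sum ((t ∖ g zero) ∘ g ∘ suc)
      ≡⟨ cong (t (g zero) ∙_) (sum-cong-≗ λ j → updateAt-minimal (g (suc j)) (g zero) t (0≢1+n ∘ g-inj ∘ sym)) ⟩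
    t (g zero) ∙ sum (t ∘ g ∘ suc)    ∎
    where
    g∘suc-inj : Injective _≡_ _≡_ (g ∘ suc)
    g∘suc-inj = Fin-suc-injective ∘ g-inj
    outside′ : ∀ v → ¬ (∃[ j ] g (suc j) ≡ v) → (t ∖ g zero) v ≈ ε
    outside′ v v∉g∘suc with v ≟ g zero
    ... | yes refl = reflexive (updateAt-updates (g zero) t)
    ... | no v≢g₀ = ≈-trans (reflexive (updateAt-minimal v (g zero) t v≢g₀))
      (outside v λ { (zero , g₀≡v) → v≢g₀ (sym g₀≡v) ; (suc j , gj≡v) → v∉g∘suc (j , gj≡v) })

  sum-δ : ∀ {n} (s : Fin n) x → sum (λ v → if ⌊ s ≟ v ⌋ then x else ε) ≈ x
  sum-δ s x = ≈-trans (sum-∘-injective {k = 1} (λ _ → s) _ (λ { {zero} {zero} _ → refl }) outside)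
    (≈-trans (reflexive (cong (λ b → (if b then x else ε) ∙ ε) (⌊≟⌋-≡ refl))) (identityʳ x))
    where
    outside : ∀ v → ¬ (∃[ j ] s ≡ v) → (if ⌊ s ≟ v ⌋ then x else ε) ≈ ε
    outside v s∉ = reflexive (cong (λ b → if b then x else ε) (⌊≟⌋-≢ λ s≡v → s∉ (zero , s≡v)))

module KSum = FiniteSum ⊕-commutativeMonoid
module ℕSum = FiniteSum +-0-commutativeMonoid

sumK≡∑ : ∀ m (f : Fin m → K) → sumK m f ≡ KSum.sum f
sumK≡∑ zero    f = refl
sumK≡∑ (suc m) f = cong (f zero ⊕_) (sumK≡∑ m (f ∘ suc))

sumℕ≡∑ : ∀ m (f : Fin m → ℕ) → sumℕ m f ≡ ℕSum.sum f
sumℕ≡∑ zero    f = refl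
sumℕ≡∑ (suc m) f = cong (f zero +_) (sumℕ≡∑ m (f ∘ suc))

sumK-cong : ∀ m {f g : Fin m → K} → (∀ i → f i ≡ g i) → sumK m f ≡ sumK m g
sumK-cong zero    f≗g = refl
sumK-cong (suc m) f≗g = cong₂ _⊕_ (f≗g zero) (sumK-cong m (f≗g ∘ suc))

sumK-∘-injective : ∀ {k n} (g : Fin k → Fin n) (t : Fin n → K) → Injective _≡_ _≡_ g →
  (∀ v → ¬ (∃[ j ] g j ≡ v) → t v ≡ 0K) → sumK n t ≡ sumK k (t ∘ g)
sumK-∘-injective {k} {n} g t g-inj outside = begin
  sumK n t         ≡⟨ sumK≡∑ n t ⟩
  KSum.sum t       ≡⟨ KSum.sum-∘-injective g t g-inj outside ⟩
  KSum.sum (t ∘ g) ≡⟨ sumK≡∑ k (t ∘ g) ⟨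
  sumK k (t ∘ g)   ∎
  where open ≡-Reasoning

≤-sumℕ : ∀ m (t : Fin m → ℕ) i → t i ≤ sumℕ m t
≤-sumℕ m t i = subst (t i ≤_) (sym (trans (sumℕ≡∑ m t) (ℕSum.sum-∖ t i))) (m≤m+n (t i) _)

m+n≡1⇒m≡1∧n≡0 : ∀ {m n} → 1 ≤ m → m + n ≡ 1 → m ≡ 1 × n ≡ 0
m+n≡1⇒m≡1∧n≡0 {suc zero}    {zero}  _ _  = refl , refl
m+n≡1⇒m≡1∧n≡0 {suc zero}    {suc _} _ ()
m+n≡1⇒m≡1∧n≡0 {suc (suc _)}         _ ()

three-units : ∀ {m} (f : Fin m → ℕ) {a b c} → b ≢ a → c ≢ a → c ≢ b →
  f a ≡ 1 → f b ≡ 1 → 1 ≤ f c → sumℕ m f ≡ 3 →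
  f c ≡ 1 × (∀ e → e ≢ a → e ≢ b → e ≢ c → f e ≡ 0)
three-units {m} f {a} {b} {c} b≢a c≢a c≢b fa≡1 fb≡1 1≤fc total =
  fc≡1 , λ e e≢a e≢b e≢c → n≤0⇒n≡0 (subst₂ _≤_ (rest-agrees e≢a e≢b e≢c) ∑rest≡0 (≤-sumℕ m rest e))
  where
  open ℕSum using (sum; sum-∖; _∖_)
  open ≡-Reasoning
  rest : Fin m → ℕ
  rest = f ∖ a ∖ b ∖ c
  rest-agrees : ∀ {e} → e ≢ a → e ≢ b → e ≢ c → rest e ≡ f e
  rest-agrees {e} e≢a e≢b e≢c = trans (updateAt-minimal e c _ e≢c)
    (trans (updateAt-minimal e b _ e≢b) (updateAt-minimal e a f e≢a))
  fc+∑rest≡1 : f c + sumℕ m rest ≡ 1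
  fc+∑rest≡1 = suc-injective (suc-injective (begin
    1 + (1 + (f c + sumℕ m rest))    ≡⟨ cong₂ (λ x y → x + (y + (f c + sumℕ m rest))) fa≡1 fb≡1 ⟨
    f a + (f b + (f c + sumℕ m rest)) ≡⟨ cong (λ s → f a + (f b + (f c + s))) (sumℕ≡∑ m rest) ⟩
    f a + (f b + (f c + sum rest))    ≡⟨ cong (λ x → f a + (f b + (x + sum rest))) f∖a∖b≗f ⟨
    f a + (f b + ((f ∖ a ∖ b) c + sum rest))
      ≡⟨ cong (λ x → f a + (x + ((f ∖ a ∖ b) c + sum rest))) (updateAt-minimal b a f b≢a) ⟨
    f a + ((f ∖ a) b + ((f ∖ a ∖ b) c + sum rest))
      ≡⟨ cong (λ x → f a + ((f ∖ a) b + x)) (sum-∖ (f ∖ a ∖ b) c) ⟨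
    f a + ((f ∖ a) b + sum (f ∖ a ∖ b)) ≡⟨ cong (f a +_) (sum-∖ (f ∖ a) b) ⟨
    f a + sum (f ∖ a)                   ≡⟨ sum-∖ f a ⟨
    sum f                               ≡⟨ sumℕ≡∑ m f ⟨
    sumℕ m f                            ≡⟨ total ⟩
    3                                   ∎))
    where
    f∖a∖b≗f : (f ∖ a ∖ b) c ≡ f c
    f∖a∖b≗f = trans (updateAt-minimal c b _ c≢b) (updateAt-minimal c a f c≢a)
  fc≡1 : f c ≡ 1
  fc≡1 = proj₁ (m+n≡1⇒m≡1∧n≡0 1≤fc fc+∑rest≡1)
  ∑rest≡0 : sumℕ m rest ≡ 0
  ∑rest≡0 = proj₂ (m+n≡1⇒m≡1∧n≡0 1≤fc fc+∑rest≡1)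

prev : Fin 5 → Fin 5
prev 0F = 4F
prev 1F = 0F
prev 2F = 1F
prev 3F = 2F
prev 4F = 3F

next-prev : ∀ i → next (prev i) ≡ i
next-prev 0F = refl
next-prev 1F = refl
next-prev 2F = refl
next-prev 3F = refl
next-prev 4F = refl

next≢ : ∀ i → next i ≢ i
next≢ 0F ()
next≢ 1F ()
next≢ 2F ()
next≢ 3F ()
next≢ 4F ()

prev≢ : ∀ i → prev i ≢ i
prev≢ 0F ()
prev≢ 1F ()
prev≢ 2F ()
prev≢ 3F ()
prev≢ 4F ()

ThreeInARow : (Fin 5 → K) → Fin 5 → Set
ThreeInARow a i = (a i ≡ a (next i)) × (a (next i) ≡ a (next (next i)))

Balances : (Fin 5 → K) → (Fin 5 → K) → Set
Balances a c = ∀ j → c (prev j) ⊕ c j ≡ a j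

Balanceable : (Fin 5 → K) → Set
Balanceable a = ∃[ c ] ((∀ j → c j ≢ 0K) × Balances a c)

Balanceable-∘next : ∀ a → Balanceable (a ∘ next) → Balanceable a
Balanceable-∘next a (c , c≢0 , balances) = c ∘ prev , c≢0 ∘ prev , balances′
  where
  balances′ : Balances a (c ∘ prev)
  balances′ j = subst (λ k → c (prev (prev j)) ⊕ c (prev j) ≡ a k) (next-prev j) (balances (prev j))

sumK-∘next : ∀ a → sumK 5 (a ∘ next) ≡ sumK 5 a
sumK-∘next a = solve 5 (λ x₀ x₁ x₂ x₃ x₄ →
    x₁ ⊞ (x₂ ⊞ (x₃ ⊞ (x₄ ⊞ (x₀ ⊞ id)))) ⊜ x₀ ⊞ (x₁ ⊞ (x₂ ⊞ (x₃ ⊞ (x₄ ⊞ id)))))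
  refl (a 0F) (a 1F) (a 2F) (a 3F) (a 4F)
  where open import Algebra.Solver.CommutativeMonoid ⊕-commutativeMonoid
          using (solve; _⊜_; id) renaming (_⊕_ to _⊞_)

balanceable-from-0 : ∀ a → sumK 5 a ≡ 0K → ThreeInARow a 0F → Balanceable a
balanceable-from-0 a total (a₀≡a₁ , a₁≡a₂) with avoid-0-and-two (a 0F) (a 3F)
... | y , y≢0 , y≢a₀ , y≢a₃ = c , c≢0 , balances
  where
  p q : K
  p = a 0F
  q = a 3F
  c : Fin 5 → K
  c = y ∷ y ⊕ p ∷ y ∷ y ⊕ q ∷ y ⊕ p ∷ []
  c≢0 : ∀ j → c j ≢ 0K
  c≢0 0F = y≢0
  c≢0 1F = y≢a₀ ∘ ⊕≡0K⇒≡
  c≢0 2F = y≢0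
  c≢0 3F = y≢a₃ ∘ ⊕≡0K⇒≡
  c≢0 4F = y≢a₀ ∘ ⊕≡0K⇒≡
  q⊕p≡a₄ : q ⊕ p ≡ a 4F
  q⊕p≡a₄ = trans (⊕-comm q p) (⊕≡0K⇒≡ (begin
    (p ⊕ q) ⊕ a 4F                       ≡⟨ ⊕-assoc p q (a 4F) ⟩
    p ⊕ (q ⊕ a 4F)                       ≡⟨ cong (λ x → p ⊕ (q ⊕ x)) (⊕-identityʳ (a 4F)) ⟨
    p ⊕ (q ⊕ (a 4F ⊕ 0K))                ≡⟨ ⊕-cancelˡ p _ ⟨
    p ⊕ (p ⊕ (p ⊕ (q ⊕ (a 4F ⊕ 0K))))    ≡⟨ cong₂ (λ x z → p ⊕ (x ⊕ (z ⊕ (q ⊕ (a 4F ⊕ 0K))))) a₀≡a₁ (trans a₀≡a₁ a₁≡a₂) ⟩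
    sumK 5 a                             ≡⟨ total ⟩
    0K                                   ∎))
    where open ≡-Reasoning
  balances : Balances a c
  balances 0F = ⊕-cancelʳ y p
  balances 1F = trans (⊕-cancelˡ y p) a₀≡a₁
  balances 2F = trans (⊕-cancelʳ y p) (trans a₀≡a₁ a₁≡a₂)
  balances 3F = ⊕-cancelˡ y q
  balances 4F = trans (⊕-difference y q p) q⊕p≡a₄

BalanceableAt : Fin 5 → Set
BalanceableAt i = ∀ a → sumK 5 a ≡ 0K → ThreeInARow a i → Balanceable a

BalanceableAt-next : ∀ i → BalanceableAt i → BalanceableAt (next i)
BalanceableAt-next i balance a total three =
  Balanceable-∘next a (balance (a ∘ next) (trans (sumK-∘next a) total) three)

balanceable : ∀ i → BalanceableAt i
balanceable 0F = balanceable-from-0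
balanceable 1F = BalanceableAt-next 0F balanceable-from-0
balanceable 2F = BalanceableAt-next 1F (BalanceableAt-next 0F balanceable-from-0)
balanceable 3F = BalanceableAt-next 2F (BalanceableAt-next 1F (BalanceableAt-next 0F balanceable-from-0))
balanceable 4F =
  BalanceableAt-next 3F (BalanceableAt-next 2F (BalanceableAt-next 1F (BalanceableAt-next 0F balanceable-from-0)))

b2n+b2n≡1⇒xor : ∀ x y → b2n x + b2n y ≡ 1 → x xor y ≡ true
b2n+b2n≡1⇒xor true  false _ = refl
b2n+b2n≡1⇒xor false true  _ = refl
b2n+b2n≡1⇒xor true  true  ()
b2n+b2n≡1⇒xor false false ()

b2n+b2n≡0⇒xor : ∀ x y → b2n x + b2n y ≡ 0 → x xor y ≡ false
b2n+b2n≡0⇒xor false false _ = refl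
b2n+b2n≡0⇒xor true  _     ()
b2n+b2n≡0⇒xor false true  ()

xor≡true : ∀ x y → x xor y ≡ true → x ≡ true ⊎ y ≡ true
xor≡true true  _ _        = inj₁ refl
xor≡true false _ y≡true   = inj₂ y≡true

if-xor-⊕ : ∀ x y k → (if x xor y then k else 0K) ≡ (if x then k else 0K) ⊕ (if y then k else 0K)
if-xor-⊕ true  true  k = sym (⊕-self k)
if-xor-⊕ true  false k = sym (⊕-identityʳ k)
if-xor-⊕ false _     k = refl

∷³-injective : ∀ {A : Set} {x y z : A} → y ≢ x → z ≢ x → z ≢ y → Injective _≡_ _≡_ (x ∷ y ∷ z ∷ [])
∷³-injective _   _   _   {0F} {0F} _    = refl
∷³-injective y≢x _   _   {0F} {1F} x≡y  = ⊥-elim (y≢x (sym x≡y))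
∷³-injective _   z≢x _   {0F} {2F} x≡z  = ⊥-elim (z≢x (sym x≡z))
∷³-injective y≢x _   _   {1F} {0F} y≡x  = ⊥-elim (y≢x y≡x)
∷³-injective _   _   _   {1F} {1F} _    = refl
∷³-injective _   _   z≢y {1F} {2F} y≡z  = ⊥-elim (z≢y (sym y≡z))
∷³-injective _   z≢x _   {2F} {0F} z≡x  = ⊥-elim (z≢x z≡x)
∷³-injective _   _   z≢y {2F} {1F} z≡y  = ⊥-elim (z≢y z≡y)
∷³-injective _   _   _   {2F} {2F} _    = refl

module _ (G : Graph) where

  ends : Edge G → Vertex G → ℕ
  ends e v = b2n ⌊ src G e ≟ v ⌋ + b2n ⌊ tgt G e ≟ v ⌋

  boundarySum : Chain G → Vertex G → K
  boundarySum χ v = sumK (m G) (λ e → if inBoundary G v e then χ e else 0K)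

  Joins⇒ends≡1 : ∀ {e u w} → Joins G e u w → u ≢ w → ends e u ≡ 1 × ends e w ≡ 1
  Joins⇒ends≡1 (inj₁ (refl , refl)) u≢w =
    cong₂ (λ x y → b2n x + b2n y) (⌊≟⌋-≡ refl) (⌊≟⌋-≢ (u≢w ∘ sym)) ,
    cong₂ (λ x y → b2n x + b2n y) (⌊≟⌋-≢ u≢w) (⌊≟⌋-≡ refl)
  Joins⇒ends≡1 (inj₂ (refl , refl)) u≢w =
    cong₂ (λ x y → b2n x + b2n y) (⌊≟⌋-≢ (u≢w ∘ sym)) (⌊≟⌋-≡ refl) ,
    cong₂ (λ x y → b2n x + b2n y) (⌊≟⌋-≡ refl) (⌊≟⌋-≢ u≢w)

  Incident⇒1≤ends : ∀ {e v} → Incident G v e → 1 ≤ ends e v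
  Incident⇒1≤ends (inj₁ s≡v) rewrite ⌊≟⌋-≡ s≡v = s≤s z≤n
  Incident⇒1≤ends {e} {v} (inj₂ t≡v) rewrite ⌊≟⌋-≡ t≡v = m≤n+m 1 (b2n ⌊ src G e ≟ v ⌋)

  inBoundary⇒Incident : ∀ {e v} → inBoundary G v e ≡ true → Incident G v e
  inBoundary⇒Incident {e} {v} e∈∂v with xor≡true _ _ e∈∂v
  ... | inj₁ s≟v = inj₁ (⌊≟⌋⇒≡ (src G e) v s≟v)
  ... | inj₂ t≟v = inj₂ (⌊≟⌋⇒≡ (tgt G e) v t≟v)

  Joins∧Incident⇒ : ∀ {e u w v} → Joins G e u w → Incident G v e → u ≡ v ⊎ w ≡ v
  Joins∧Incident⇒ (inj₁ (s≡u , _))   (inj₁ s≡v) = inj₁ (trans (sym s≡u) s≡v)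
  Joins∧Incident⇒ (inj₁ (_   , t≡w)) (inj₂ t≡v) = inj₂ (trans (sym t≡w) t≡v)
  Joins∧Incident⇒ (inj₂ (s≡w , _))   (inj₁ s≡v) = inj₂ (trans (sym s≡w) s≡v)
  Joins∧Incident⇒ (inj₂ (_   , t≡u)) (inj₂ t≡v) = inj₁ (trans (sym t≡u) t≡v)

  ∑-boundarySum : ∀ χ → sumK (n G) (boundarySum χ) ≡ 0K
  ∑-boundarySum χ = begin
    sumK (n G) (boundarySum χ)         ≡⟨ sumK≡∑ (n G) _ ⟩
    sum (boundarySum χ)                ≡⟨ sum-cong-≗ (λ v → sumK≡∑ (m G) (term v)) ⟩
    ∑[ v < n G ] ∑[ e < m G ] term v e ≡⟨ ∑-comm term ⟩
    ∑[ e < m G ] ∑[ v < n G ] term v e ≡⟨ sum-cong-≗ edge-contribution ⟩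
    ∑[ e < m G ] 0K                    ≡⟨ sum-zero {m G} _ (λ _ → refl) ⟩
    0K                                 ∎
    where
    open KSum
    open ≡-Reasoning
    term : Vertex G → Edge G → K
    term v e = if inBoundary G v e then χ e else 0K
    edge-contribution : ∀ e → ∑[ v < n G ] term v e ≡ 0K
    edge-contribution e = begin
      ∑[ v < n G ] term v e
        ≡⟨ sum-cong-≗ (λ v → if-xor-⊕ ⌊ src G e ≟ v ⌋ ⌊ tgt G e ≟ v ⌋ (χ e)) ⟩
      ∑[ v < n G ] (end-at (src G e) v ⊕ end-at (tgt G e) v)
        ≡⟨ ∑-distrib-+ (end-at (src G e)) (end-at (tgt G e)) ⟩
      sum (end-at (src G e)) ⊕ sum (end-at (tgt G e))
        ≡⟨ cong₂ _⊕_ (sum-δ (src G e) (χ e)) (sum-δ (tgt G e) (χ e)) ⟩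
      χ e ⊕ χ e
        ≡⟨ ⊕-self (χ e) ⟩
      0K
        ∎
      where
      end-at : Vertex G → Vertex G → K
      end-at s v = if ⌊ s ≟ v ⌋ then χ e else 0K

module _ {G : Graph} (C : Circuit5 G) where

  circuit-edge-ends : ∀ j → ends G (edg C j) (vtx C j) ≡ 1 × ends G (edg C j) (vtx C (next j)) ≡ 1
  circuit-edge-ends j = Joins⇒ends≡1 G (edg-join C j) (next≢ j ∘ sym ∘ vtx-inj C)

  InE∧Incident⇒InV : ∀ {e v} → InE C e → Incident G v e → InV C v
  InE∧Incident⇒InV (j , refl) v∈e with Joins∧Incident⇒ G (edg-join C j) v∈e
  ... | inj₁ vⱼ≡v = j , vⱼ≡v
  ... | inj₂ vⱼ₊₁≡v = next j , vⱼ₊₁≡v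

  boundarySum-outside : ∀ {χ χ′ v} → ¬ InV C v → (∀ e → ¬ InE C e → χ e ≡ χ′ e) →
    boundarySum G χ v ≡ boundarySum G χ′ v
  boundarySum-outside {χ} {χ′} {v} v∉C agree = sumK-cong (m G) term
    where
    term : ∀ e → (if inBoundary G v e then χ e else 0K) ≡ (if inBoundary G v e then χ′ e else 0K)
    term e with inBoundary G v e in e∈∂v
    ... | false = refl
    ... | true  = agree e λ e∈C → v∉C (InE∧Incident⇒InV e∈C (inBoundary⇒Incident G e∈∂v))

  onCircuit : (Fin 5 → K) → Chain G → Chain G
  onCircuit c χ e with any? (λ j → edg C j ≟ e)
  ... | yes (j , _) = c j
  ... | no _        = χ e

  onCircuit-edg : ∀ c χ j → onCircuit c χ (edg C j) ≡ c j
  onCircuit-edg c χ j with any? (λ j′ → edg C j′ ≟ edg C j)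
  ... | yes (j′ , eⱼ′≡eⱼ) = cong c (edg-inj C eⱼ′≡eⱼ)
  ... | no e∉C            = ⊥-elim (e∉C (j , refl))

  onCircuit-off : ∀ c χ {e} → ¬ InE C e → onCircuit c χ e ≡ χ e
  onCircuit-off c χ {e} e∉C with any? (λ j → edg C j ≟ e)
  ... | yes e∈C = ⊥-elim (e∉C e∈C)
  ... | no _    = refl

  module _ {o : Fin 5 → Edge G} (cubic : Cubic-on G C) (natural : NaturalOrdering G C o) where

    module _ (i : Fin 5) where

      private
        v : Vertex G
        v = vtx C i
        e₋ e₊ : Edge G
        e₋ = edg C (prev i)
        e₊ = edg C i
        e₊≢e₋ : e₊ ≢ e₋
        e₊≢e₋ = prev≢ i ∘ sym ∘ edg-inj C
        oᵢ≢e₋ : o i ≢ e₋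
        oᵢ≢e₋ oᵢ≡e₋ = proj₁ (natural i) (prev i , sym oᵢ≡e₋)
        oᵢ≢e₊ : o i ≢ e₊
        oᵢ≢e₊ oᵢ≡e₊ = proj₁ (natural i) (i , sym oᵢ≡e₊)
        ends-e₋ : ends G e₋ v ≡ 1
        ends-e₋ = subst (λ j → ends G e₋ (vtx C j) ≡ 1) (next-prev i) (proj₂ (circuit-edge-ends (prev i)))
        ends-e₊ : ends G e₊ v ≡ 1
        ends-e₊ = proj₁ (circuit-edge-ends i)

      ends-at-vtx : ends G (o i) v ≡ 1 × (∀ e → e ≢ e₋ → e ≢ e₊ → e ≢ o i → ends G e v ≡ 0)
      ends-at-vtx = three-units (λ e → ends G e v) e₊≢e₋ oᵢ≢e₋ oᵢ≢e₊ ends-e₋ ends-e₊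
        (Incident⇒1≤ends G (proj₂ (natural i))) (cubic i)

      boundarySum-vtx : ∀ χ → boundarySum G χ v ≡ χ e₋ ⊕ (χ e₊ ⊕ χ (o i))
      boundarySum-vtx χ = begin
        boundarySum G χ v
          ≡⟨ sumK-∘-injective (e₋ ∷ e₊ ∷ o i ∷ []) term (∷³-injective e₊≢e₋ oᵢ≢e₋ oᵢ≢e₊) term-outside ⟩
        term e₋ ⊕ (term e₊ ⊕ (term (o i) ⊕ 0K))
          ≡⟨ cong₂ _⊕_ (term-∂ ends-e₋) (cong₂ _⊕_ (term-∂ ends-e₊) (cong (_⊕ 0K) (term-∂ (proj₁ ends-at-vtx)))) ⟩
        χ e₋ ⊕ (χ e₊ ⊕ (χ (o i) ⊕ 0K))
          ≡⟨ cong (λ x → χ e₋ ⊕ (χ e₊ ⊕ x)) (⊕-identityʳ (χ (o i))) ⟩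
        χ e₋ ⊕ (χ e₊ ⊕ χ (o i))
          ∎
        where
        open ≡-Reasoning
        term : Edge G → K
        term e = if inBoundary G v e then χ e else 0K
        term-∂ : ∀ {e} → ends G e v ≡ 1 → term e ≡ χ e
        term-∂ {e} ends≡1 = cong (λ b → if b then χ e else 0K) (b2n+b2n≡1⇒xor ⌊ src G e ≟ v ⌋ ⌊ tgt G e ≟ v ⌋ ends≡1)
        term-outside : ∀ e → ¬ (∃[ j ] (e₋ ∷ e₊ ∷ o i ∷ []) j ≡ e) → term e ≡ 0K
        term-outside e e∉ = cong (λ b → if b then χ e else 0K) (b2n+b2n≡0⇒xor ⌊ src G e ≟ v ⌋ ⌊ tgt G e ≟ v ⌋
          (proj₂ ends-at-vtx e (λ e≡ → e∉ (0F , sym e≡)) (λ e≡ → e∉ (1F , sym e≡)) (λ e≡ → e∉ (2F , sym e≡))))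

    onCircuit-vtx : ∀ c χ i → boundarySum G (onCircuit c χ) (vtx C i) ≡ c (prev i) ⊕ (c i ⊕ χ (o i))
    onCircuit-vtx c χ i = trans (boundarySum-vtx i (onCircuit c χ))
      (cong₂ _⊕_ (onCircuit-edg c χ (prev i)) (cong₂ _⊕_ (onCircuit-edg c χ i) (onCircuit-off c χ (proj₁ (natural i)))))

    module _ {φ : Chain G} (extensible : Extensible G C φ) where

      onCircuit-outside : ∀ c {v} → ¬ InV C v → ZeroSum G (onCircuit c φ) v
      onCircuit-outside c {v} v∉C = trans (boundarySum-outside v∉C (λ _ → onCircuit-off c φ)) (extensible v v∉C)

      ∑-boundary-values : sumK 5 (φ ∘ o) ≡ 0K
      ∑-boundary-values = begin
        sumK 5 (φ ∘ o)                      ≡⟨ sumK-cong 5 (λ i → sym (onCircuit-vtx (λ _ → 0K) φ i)) ⟩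
        sumK 5 (boundarySum G ψ ∘ vtx C)    ≡⟨ sumK-∘-injective (vtx C) _ (vtx-inj C) (λ _ → onCircuit-outside _) ⟨
        sumK (n G) (boundarySum G ψ)        ≡⟨ ∑-boundarySum G ψ ⟩
        0K                                  ∎
        where
        open ≡-Reasoning
        ψ : Chain G
        ψ = onCircuit (λ _ → 0K) φ

      onCircuit-flow : ∀ c → Balances (φ ∘ o) c → Flow G (onCircuit c φ)
      onCircuit-flow c balances v with any? (λ j → vtx C j ≟ v)
      ... | yes (i , refl) = trans (onCircuit-vtx c φ i) (x⊕y≡z⇒x⊕[y⊕z]≡0K {c (prev i)} {c i} (balances i))
      ... | no v∉C        = onCircuit-outside c v∉C

lemma5 : (G : Graph) (C : Circuit5 G) (φ : Chain G) (o : Fin 5 → Edge G)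
    → Cubic-on G C
    → Extensible G C φ
    → NowhereZeroBoundary G C φ
    → NaturalOrdering G C o
    → (∃[ i ] ((φ (o i) ≡ φ (o (next i))) × (φ (o (next i)) ≡ φ (o (next (next i))))))
    → ∃[ φ' ] (Extension G C φ φ' × (∀ e → InE C e → ¬ Z G φ' e))
lemma5 G C φ o cubic extensible _ natural (i , three) =
  extend (balanceable i (φ ∘ o) (∑-boundary-values C cubic natural extensible) three)
  where
  extend : Balanceable (φ ∘ o) → ∃[ φ' ] (Extension G C φ φ' × (∀ e → InE C e → ¬ Z G φ' e))
  extend (c , c≢0 , balances) =
    onCircuit C c φ , (onCircuit-flow C cubic natural extensible c balances , λ _ → onCircuit-off C c φ) ,
    λ { _ (j , refl) → c≢0 j ∘ trans (sym (onCircuit-edg C c φ j)) }
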